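{- Let $A$ be a two-counter (Minsky) automaton with finite state set $Q$, initial state $q_0$ and a set of final states, and let $L_A$ be the language defined in the context. The following are equivalent: (i) $A$, started in $q_0$ with both counters empty (equal to $0$), accepts (reaches a final state); (ii) there exist a word $w\in L_A$ and a natural number $n$ such that every configuration of $w$, except the last one (which consists of a single symbol), has length $n-1$, and every shade in $w$ has length $n$ (counting the two end symbols of the shade).
   Context: Instructions of $A$ have the form: "if in state $q$, the first counter equals / does not equal $0$ and the second counter equals / does not equal $0$, then change the state to $q_1$ and decrease / increase / keep unchanged the first counter and decrease / increase / keep unchanged the second counter." Let $Q'=\{q':q\in Q\}$ be a disjoint copy of $Q$ and $B=\{f,f_l,f_r,f',f'_l,f'_r,s,s_l,s_r,s',s'_l,s'_r\}$. The alphabet $\Sigma$ consists of all elements of $Q\cup Q'$ (called states) and all subsets $X\subseteq B$ containing at most one element of each of $\{f,f_l,f_r\}$, $\{f',f'_l,f'_r\}$, $\{s,s_l,s_r\}$, $\{s',s'_l,s'_r\}$. A non-state symbol containing $f_l$ or $f'_l$ (resp. $s_l$ or $s'_l$) is a first (resp. second) counter; one containing $f_r$ or $f'_r$ (resp. $s_r$ or $s'_r$) is a first (resp. second) shadow. For a word $w$ over $\Sigma$, a configuration is a maximal infix whose first symbol is a state (its state) and which contains exactly one state; it is even if its state is in $Q$ and odd if in $Q'$. $L_A$ consists of the words $w$ over $\Sigma$ satisfying: (1) the first symbol is $q_0$ and the last symbol is $q$ or $q'$ for a final state $q$; (2) odd and even configurations alternate; (3) every configuration except the last (which consists only of its state)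 contains exactly one first counter and exactly one second counter; in even configurations these contain $f_l$ and $s_l$ respectively, in odd ones $f'_l$ and $s'_l$; the first non-state symbol of the first configuration is both a first and a second counter; (4) the first and last configurations contain no shadows; every other configuration contains exactly one first shadow and exactly one second shadow, containing $f'_r$ and $s'_r$ if the configuration is even, and $f_r$ and $s_r$ if odd. (Hence a counter containing $f_l$ (resp. $f'_l,s_l,s'_l$) is followed in the next configuration by its shadow containing $f_r$ (resp. $f'_r,s_r,s'_r$); the infix from a first (second) counter to its shadow, inclusive, is called a first (second) shade.) (5) a non-state symbol contains $f$ (resp. $f',s,s'$) iff it lies inside some shade beginning with a symbol containing $f_l$ (resp. $f'_l,s_l,s'_l$); (6) say a configuration has first (second) counter equal to zero if its first non-state symbol contains $f_l$ or $f'_l$ (resp. $s_l$ or $s'_l$); a configuration $C$ matches the assumption of an instruction $I$ if its state is $q$ or $q'$ for the state $q$ of $I$ and its counter-zero tests agree with those of $I$. If $C,C_1$ are consecutive configurations and $C$ matches the assumption of $I$, then: the state of $C_1$ is the new state $q_1$ of $I$ (as $q_1$ or $q_1'$ according to the parity of $C_1$); if $I$ keeps the first (second) counter unchanged, the first (second) counter of $C_1$ is the same symbol as the first (second) shadow of $C_1$; if $I$ decreases it, the counter of $C_1$ is the immediate predecessor of the corresponding shadow in $C_1$; if $I$ increases it, the counter of $C_1$ is the immediate successor of the corresponding shadow in $C_1$.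
   Formalization: A has at most one instruction per state and pair of zero tests, every non-final state has one for each pair, and no instruction decreases a counter it tests equal to 0. The statement above fails without it. -}

module Defs where

open import Data.Nat using (ℕ; zero; suc; _∸_)
open import Data.Bool using (Bool; true; false)
open import Data.Fin using (Fin; toℕ)
open import Data.Fin.Subset using (Subset; _∈_; _∉_)
open import Data.Maybe using (Maybe; just; nothing)
open import Data.List using (List; []; _∷_; length; lookup; _∷ʳ_)
open import Data.Product using (Σ; ∃; ∃-syntax; _×_; _,_)
open import Data.Sum using (_⊎_)
open import Data.Empty using (⊥)
open import Data.Unit using (⊤)
open import Relation.Nullary using (¬_)
open import Relation.Binary.PropositionalEquality using (_≡_; _≢_)
open import Relation.Binary.Construct.Closure.ReflexiveTransitive using (Star)
import Data.List.Membership.Propositional as LM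
import Data.Nat as N

data Act : Set where
  dec inc keep : Act

-- "if in state from, first counter =0 (zero₁ = true) / ≠0 (zero₁ = false),
--  second counter =0 / ≠0 (zero₂), then go to state to and apply act₁, act₂"
record Instr (k : ℕ) : Set where
  constructor instr
  field
    from  : Fin k
    zero₁ : Bool
    zero₂ : Bool
    to    : Fin k
    act₁  : Act
    act₂  : Act
open Instr public

record Automaton (k : ℕ) : Set where
  field
    instrs : List (Instr k)
    q₀     : Fin k
    final  : Subset k
open Automaton public

module _ {k : ℕ} (A : Automaton k) where
  open LM using () renaming (_∈_ to _∈ˡ_)

  Deterministic : Set
  Deterministic = ∀ I J → I ∈ˡ instrs A → J ∈ˡ instrs A →
    from I ≡ from J → zero₁ I ≡ zero₁ J → zero₂ I ≡ zero₂ J → I ≡ J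

  Complete : Set
  Complete = ∀ q → q ∉ final A → ∀ b₁ b₂ →
    ∃[ I ] (I ∈ˡ instrs A × from I ≡ q × zero₁ I ≡ b₁ × zero₂ I ≡ b₂)

  NoZeroDecrement : Set
  NoZeroDecrement = ∀ I → I ∈ˡ instrs A →
    (zero₁ I ≡ true → act₁ I ≢ dec) × (zero₂ I ≡ true → act₂ I ≢ dec)

isZero : ℕ → Bool
isZero zero    = true
isZero (suc _) = false

apply : Act → ℕ → ℕ
apply dec  n = n ∸ 1
apply inc  n = suc n
apply keep n = n

MConf : ℕ → Set
MConf k = Fin k × ℕ × ℕ

module _ {k : ℕ} (A : Automaton k) where
  open LM using () renaming (_∈_ to _∈ˡ_)

  Step : MConf k → MConf k → Set
  Step (q , a , b) (q' , a' , b') = ∃[ I ] (I ∈ˡ instrs A ×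
    from I ≡ q × zero₁ I ≡ isZero a × zero₂ I ≡ isZero b ×
    to I ≡ q' × a' ≡ apply (act₁ I) a × b' ≡ apply (act₂ I) b)

  Accepts : Set
  Accepts = ∃[ q ] ∃[ a ] ∃[ b ]
    (Star Step (q₀ A , 0 , 0) (q , a , b) × q ∈ final A)

-- B = {f,f_l,f_r,f',f'_l,f'_r,s,s_l,s_r,s',s'_l,s'_r} is Group × Mark:
--   group F = {f,f_l,f_r}, F' = {f',f'_l,f'_r}, S = {s,s_l,s_r}, S' = {s',s'_l,s'_r};
--   mark plain = no subscript, l = subscript l, r = subscript r.
-- A subset X ⊆ B with at most one element of each group is the same as
-- a choice, for each group, of nothing or one mark.

data Group : Set where
  F F' S S' : Group

data Mark : Set where
  plain l r : Mark

Letter : Set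
Letter = Group → Maybe Mark   -- X ∋ (g , m)  iff  X g ≡ just m

data Sym (k : ℕ) : Set where
  st  : Fin k → Sym k
  st' : Fin k → Sym k
  ns  : Letter → Sym k

module _ {k : ℕ} where

  Has : Sym k → Group → Mark → Set
  Has (ns X)  g m = X g ≡ just m
  Has (st _)  g m = ⊥
  Has (st' _) g m = ⊥

  IsState : Sym k → Set
  IsState (st _)  = ⊤
  IsState (st' _) = ⊤
  IsState (ns _)  = ⊥

  EvenState OddState : Sym k → Set
  EvenState x = ∃[ q ] (x ≡ st q)
  OddState  x = ∃[ q ] (x ≡ st' q)

  stateOf : Sym k → Maybe (Fin k)
  stateOf (st q)  = just q
  stateOf (st' q) = just q
  stateOf (ns _)  = nothing

  FirstCounter SecondCounter FirstShadow SecondShadow : Sym k → Set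
  FirstCounter  x = Has x F l ⊎ Has x F' l
  SecondCounter x = Has x S l ⊎ Has x S' l
  FirstShadow   x = Has x F r ⊎ Has x F' r
  SecondShadow  x = Has x S r ⊎ Has x S' r

Word : ℕ → Set
Word k = List (Sym k)

Pos : ∀ {k} → Word k → Set
Pos w = Fin (length w)

module _ {k : ℕ} (w : Word k) where

  _at_ : Pos w → Sym k
  _at_ i = lookup w i

  St : Pos w → Set
  St i = IsState (_at_ i)

  _<ᵖ_ _≤ᵖ_ : Pos w → Pos w → Set
  i <ᵖ j = toℕ i N.< toℕ j
  i ≤ᵖ j = toℕ i N.≤ toℕ j

  -- position i lies in the configuration whose state is at position s
  InConf : Pos w → Pos w → Set
  InConf s i = St s × s ≤ᵖ i × (∀ j → s <ᵖ j → j ≤ᵖ i → ¬ St j)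

  Next : Pos w → Pos w → Set
  Next s s' = St s × St s' × s <ᵖ s' × (∀ j → s <ᵖ j → j <ᵖ s' → ¬ St j)

  IsFirst : Pos w → Set
  IsFirst s = toℕ s ≡ 0

  IsLast : Pos w → Set
  IsLast s = St s × (∀ j → s <ᵖ j → ¬ St j)

  ExactlyOne : Pos w → (Sym k → Set) → Set
  ExactlyOne s P = ∃[ i ] ((InConf s i × P (_at_ i)) ×
    (∀ j → InConf s j → P (_at_ j) → j ≡ i))

  NoneIn : Pos w → (Sym k → Set) → Set
  NoneIn s P = ∀ i → InConf s i → ¬ P (_at_ i)

  FirstShade SecondShade Shade : Pos w → Pos w → Set
  FirstShade i j = ∃[ s ] ∃[ s' ] (Next s s' ×
    InConf s i × FirstCounter (_at_ i) × InConf s' j × FirstShadow (_at_ j))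
  SecondShade i j = ∃[ s ] ∃[ s' ] (Next s s' ×
    InConf s i × SecondCounter (_at_ i) × InConf s' j × SecondShadow (_at_ j))
  Shade i j = FirstShade i j ⊎ SecondShade i j

  -- counter of configuration s equal to zero: its first non-state symbol
  -- (necessarily at position s+1) is a first (second) counter
  FirstZero SecondZero : Pos w → Set
  FirstZero  s = ∃[ i ] (toℕ i ≡ suc (toℕ s) × FirstCounter  (_at_ i))
  SecondZero s = ∃[ i ] (toℕ i ≡ suc (toℕ s) × SecondCounter (_at_ i))

-- Agree b P : the zero test b ("=0" if true, "≠0" if false) agrees with P
Agree : Bool → Set → Set
Agree true  P = P
Agree false P = ¬ P

module _ {k : ℕ} (w : Word k) where

  Moves : Act → Pos w → Pos w → Set
  Moves keep c h = toℕ c ≡ toℕ h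
  Moves dec  c h = suc (toℕ c) ≡ toℕ h
  Moves inc  c h = toℕ c ≡ suc (toℕ h)

module _ {k : ℕ} (A : Automaton k) (w : Word k) where
  open LM using () renaming (_∈_ to _∈ˡ_)

  FinalSym : Sym k → Set
  FinalSym x = ∃[ q ] (q ∈ final A × (x ≡ st q ⊎ x ≡ st' q))

  Cond1 : Set
  Cond1 = (∃[ u ] (w ≡ st (q₀ A) ∷ u)) × (∃[ u ] ∃[ x ] (w ≡ u ∷ʳ x × FinalSym x))

  Cond2 : Set
  Cond2 = ∀ s s' → Next w s s' →
    (EvenState (w at s) × OddState (w at s')) ⊎ (OddState (w at s) × EvenState (w at s'))

  Cond3 : Set
  Cond3 =
    (∀ s → St w s → ¬ IsLast w s →
       ExactlyOne w s FirstCounter × ExactlyOne w s SecondCounter ×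
       (∀ i → InConf w s i → FirstCounter (w at i) →
          (EvenState (w at s) → Has (w at i) F l) × (OddState (w at s) → Has (w at i) F' l)) ×
       (∀ i → InConf w s i → SecondCounter (w at i) →
          (EvenState (w at s) → Has (w at i) S l) × (OddState (w at s) → Has (w at i) S' l)))
    ×
    (∀ i → toℕ i ≡ 1 → ¬ St w i → FirstCounter (w at i) × SecondCounter (w at i))

  Cond4 : Set
  Cond4 =
    (∀ s → St w s → IsFirst w s ⊎ IsLast w s →
       NoneIn w s FirstShadow × NoneIn w s SecondShadow)
    ×
    (∀ s → St w s → ¬ IsFirst w s → ¬ IsLast w s →
       ExactlyOne w s FirstShadow × ExactlyOne w s SecondShadow ×
       (∀ i → InConf w s i → FirstShadow (w at i) →
          (EvenState (w at s) → Has (w at i) F' r) × (OddState (w at s) → Has (w at i) F r)) ×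
       (∀ i → InConf w s i → SecondShadow (w at i) →
          (EvenState (w at s) → Has (w at i) S' r) × (OddState (w at s) → Has (w at i) S r)))

  Cond5 : Set
  Cond5 = ∀ (g : Group) (i : Pos w) → ¬ St w i →
    (Has (w at i) g plain → ∃[ a ] ∃[ b ] (Shade w a b × toℕ a N.< toℕ i × toℕ i N.< toℕ b × Has (w at a) g l))
    × (∃[ a ] ∃[ b ] (Shade w a b × toℕ a N.< toℕ i × toℕ i N.< toℕ b × Has (w at a) g l) → Has (w at i) g plain)

  MatchesAssumption : Pos w → Instr k → Set
  MatchesAssumption s I = stateOf (w at s) ≡ just (from I) ×
    Agree (zero₁ I) (FirstZero w s) × Agree (zero₂ I) (SecondZero w s)

  Cond6 : Set
  Cond6 = ∀ s s' → Next w s s' → ∀ I → I ∈ˡ instrs A → MatchesAssumption s I →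
    stateOf (w at s') ≡ just (to I) ×
    (∀ c h → InConf w s' c → FirstCounter (w at c) →
       InConf w s' h → FirstShadow (w at h) → Moves w (act₁ I) c h) ×
    (∀ c h → InConf w s' c → SecondCounter (w at c) →
       InConf w s' h → SecondShadow (w at h) → Moves w (act₂ I) c h)

  InL : Set
  InL = Cond1 × Cond2 × Cond3 × Cond4 × Cond5 × Cond6

Uniform : ∀ {k} → Word k → ℕ → Set
Uniform w n =
  (∀ s s' → Next w s s' → toℕ s' ∸ toℕ s ≡ n ∸ 1) ×
  (∀ i j → Shade w i j → suc (toℕ j ∸ toℕ i) ≡ n)

module Submission where

-- An accepting run with T steps is written as T + 1 blocks of length
-- m = T + 1 (a counter never exceeds the number of steps taken): block j
-- has the state of configuration j at offset 0 and counter c at offset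
-- 1 + (its value), and the last block is cut after its state.  Every
-- configuration then has length m and every shade m + 1 symbols.
-- Conversely, walking through a uniform word of L_A, a shade is exactly as
-- long as a configuration, so a shadow repeats the offset of the previous
-- counter and condition (6) moves the counter as the instruction chosen by
-- completeness prescribes; hence the configurations of the word trace a
-- run, which meets a final state at the latest in the last configuration.

open import Defs
open import Data.Bool using (Bool; true; false; not) renaming (_≟_ to _≟ᵇ_)
open import Data.Bool.Properties using (not-injective; ¬-not)
open import Data.Empty using (⊥-elim)
open import Data.Fin using (Fin; toℕ; fromℕ<) renaming (zero to fzero; suc to fsuc)
open import Data.Fin.Properties using (toℕ<n; toℕ-fromℕ<; toℕ-injective; fromℕ<-toℕ)
open import Data.Fin.Subset using (_∈_; _∉_)
open import Data.Fin.Subset.Properties using (_∈?_)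
open import Data.List using ([]; _∷_; length; _∷ʳ_; applyUpTo)
open import Data.List.Properties using (length-applyUpTo; lookup-applyUpTo; applyUpTo-∷ʳ)
open import Data.Maybe using (Maybe; just; nothing)
open import Data.Maybe.Properties using (just-injective)
open import Data.Nat
open import Data.Nat.DivMod
open import Data.Nat.Properties
open import Data.Product using (_×_; _,_; proj₁; proj₂; ∃-syntax; Σ)
open import Data.Sum using (_⊎_; inj₁; inj₂)
open import Data.Unit using (tt)
open import Function.Bundles using (_⇔_; mk⇔; Equivalence)
open import Function.Base using (_∘_)
open import Relation.Nullary using (¬_; Dec; yes; no)
open import Relation.Nullary.Decidable using (_×-dec_)
open import Relation.Binary.PropositionalEquality
open import Relation.Binary.Construct.Closure.ReflexiveTransitive using (Star; ε; _◅_; _◅◅_)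
import Data.List.Membership.Propositional as LM

select : {P X : Set} → Dec P → X → X → X
select (yes _) x y = x
select (no _)  x y = y

module _ {P X : Set} {x y : X} where

  select-yes : (P? : Dec P) → P → select P? x y ≡ x
  select-yes (yes _) _  = refl
  select-yes (no ¬p) p = ⊥-elim (¬p p)

  select-no : (P? : Dec P) → ¬ P → select P? x y ≡ y
  select-no (yes p) ¬p = ⊥-elim (¬p p)
  select-no (no _)  _  = refl

  select-view : (P? : Dec P) → ∀ {z} → select P? x y ≡ z → (P × x ≡ z) ⊎ (¬ P × y ≡ z)
  select-view (yes p)  e = inj₁ (p , e)
  select-view (no ¬p) e = inj₂ (¬p , e)

even : ℕ → Bool
even zero    = true
even (suc n) = not (even n)

even-suc-≢ : ∀ j {b} → even j ≡ b → even (suc j) ≢ b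
even-suc-≢ j refl e with even j
even-suc-≢ j refl () | true
even-suc-≢ j refl () | false

even-suc-≢⁻¹ : ∀ j {b} → even (suc j) ≢ b → even j ≡ b
even-suc-≢⁻¹ j ne = not-injective (¬-not ne)

module Blocks (m : ℕ) .{{_ : NonZero m}} where

  block offset : ℕ → ℕ
  block p  = p / m
  offset p = p % m

  pos : ℕ → ℕ → ℕ
  pos j o = o + j * m

  offset+block : ∀ p → p ≡ pos (block p) (offset p)
  offset+block p = m≡m%n+[m/n]*n p m

  offset<m : ∀ p → offset p < m
  offset<m p = m%n<n p m

  offset-pos : ∀ j {o} → o < m → offset (pos j o) ≡ o
  offset-pos j {o} o<m = trans ([m+kn]%n≡m%n o j m) (m<n⇒m%n≡m o<m)

  block-pos : ∀ j {o} → o < m → block (pos j o) ≡ j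
  block-pos j {o} o<m = *-cancelʳ-≡ _ j m (+-cancelˡ-≡ o _ _ (begin
    o + block (pos j o) * m                     ≡⟨ cong (_+ block (pos j o) * m) (sym (offset-pos j o<m)) ⟩
    offset (pos j o) + block (pos j o) * m      ≡⟨ sym (offset+block (pos j o)) ⟩
    o + j * m                                   ∎))
    where open ≡-Reasoning

  block-offset-injective : ∀ {p p'} → block p ≡ block p' → offset p ≡ offset p' → p ≡ p'
  block-offset-injective {p} {p'} eb eo =
    trans (offset+block p) (trans (cong₂ pos eb eo) (sym (offset+block p')))

  offset≡0⇒ : ∀ {p} → offset p ≡ 0 → p ≡ block p * m
  offset≡0⇒ {p} e = trans (offset+block p) (cong (_+ block p * m) e)

  block-mono : ∀ {p p'} → p ≤ p' → block p ≤ block p'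
  block-mono = /-monoˡ-≤ m

  block*m≤ : ∀ p → block p * m ≤ p
  block*m≤ p = m/n*n≤m p m

  <next-block : ∀ p → p < suc (block p) * m
  <next-block p = subst (_< m + block p * m) (sym (offset+block p)) (+-monoˡ-< (block p * m) (offset<m p))

  block<⇒< : ∀ {p p'} → block p < block p' → p < p'
  block<⇒< {p} {p'} lt = <-≤-trans (<next-block p) (≤-trans (*-monoˡ-≤ m lt) (block*m≤ p'))

  offset-mono : ∀ {p p'} → block p ≡ block p' → p < p' → offset p < offset p'
  offset-mono {p} {p'} e lt = +-cancelʳ-< (block p * m) (offset p) (offset p')
    (subst₂ _<_ (offset+block p) (trans (offset+block p') (cong (λ z → offset p' + z * m) (sym e))) lt)

module _ {X : Set} {R : X → X → Set} where

  steps : ∀ {x y} → Star R x y → ℕ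
  steps ε        = 0
  steps (_ ◅ ρ) = suc (steps ρ)

  _!_ : ∀ {x y} → Star R x y → ℕ → X
  _!_ {x} ε       _       = x
  _!_ {x} (_ ◅ ρ) zero    = x
  (_ ◅ ρ) ! suc j = ρ ! j

  !-zero : ∀ {x y} (ρ : Star R x y) → ρ ! 0 ≡ x
  !-zero ε       = refl
  !-zero (_ ◅ ρ) = refl

  !-steps : ∀ {x y} (ρ : Star R x y) → ρ ! steps ρ ≡ y
  !-steps ε       = refl
  !-steps (_ ◅ ρ) = !-steps ρ

  !-step : ∀ {x y} (ρ : Star R x y) j → j < steps ρ → R (ρ ! j) (ρ ! suc j)
  !-step (s ◅ ρ) zero    _         = subst (R _) (sym (!-zero ρ)) s
  !-step (s ◅ ρ) (suc j) (s≤s j<n) = !-step ρ j j<n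

data Counter : Set where
  first second : Counter

unprimed primed : Counter → Group
unprimed first  = F
unprimed second = S
primed first  = F'
primed second = S'

module _ {k : ℕ} where

  IsCounter IsShadow : Counter → Sym k → Set
  IsCounter c x = Has x (unprimed c) l ⊎ Has x (primed c) l
  IsShadow  c x = Has x (unprimed c) r ⊎ Has x (primed c) r

  value : Counter → MConf k → ℕ
  value first  (_ , a , _) = a
  value second (_ , _ , b) = b

  zeroTest : Counter → Instr k → Bool
  zeroTest first  = zero₁
  zeroTest second = zero₂

  action : Counter → Instr k → Act
  action first  = act₁
  action second = act₂

  value-initial : ∀ c {q : Fin k} → value c (q , 0 , 0) ≡ 0
  value-initial first  = refl
  value-initial second = refl

  module _ (A : Automaton k) {C C' : MConf k} where

    Step-value : (σ : Step A C C') → ∀ c → value c C' ≡ apply (action c (proj₁ σ)) (value c C)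
    Step-value (_ , _ , _ , _ , _ , _ , e , _) first  = e
    Step-value (_ , _ , _ , _ , _ , _ , _ , e) second = e

    Step-from : (σ : Step A C C') → from (proj₁ σ) ≡ proj₁ C
    Step-from (_ , _ , e , _) = e

    Step-to : (σ : Step A C C') → to (proj₁ σ) ≡ proj₁ C'
    Step-to (_ , _ , _ , _ , _ , e , _) = e

    Step-zeroTest : (σ : Step A C C') → ∀ c → zeroTest c (proj₁ σ) ≡ isZero (value c C)
    Step-zeroTest (_ , _ , _ , e , _) first  = e
    Step-zeroTest (_ , _ , _ , _ , e , _) second = e

  NoZeroDecrement-at : (A : Automaton k) → NoZeroDecrement A → ∀ {I} → I LM.∈ instrs A →
    ∀ c → zeroTest c I ≡ true → action c I ≢ dec
  NoZeroDecrement-at A nzd I∈ first  = proj₁ (nzd _ I∈)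
  NoZeroDecrement-at A nzd I∈ second = proj₂ (nzd _ I∈)

  after : Instr k → MConf k → MConf k
  after I C = to I , apply (act₁ I) (value first C) , apply (act₂ I) (value second C)

  value-after : ∀ c I C → value c (after I C) ≡ apply (action c I) (value c C)
  value-after first  I C = refl
  value-after second I C = refl

  Step-after : (A : Automaton k) → ∀ {I C} → I LM.∈ instrs A → from I ≡ proj₁ C →
    (∀ c → zeroTest c I ≡ isZero (value c C)) → Step A C (after I C)
  Step-after A {I} I∈ from≡ zeroTest≡ = I , I∈ , from≡ , zeroTest≡ first , zeroTest≡ second , refl , refl , refl

  module _ (w : Word k) where

    CounterZero : Counter → Pos w → Set
    CounterZero c s = ∃[ i ] (toℕ i ≡ suc (toℕ s) × IsCounter c (w at i))

    TrackShade : Counter → Pos w → Pos w → Set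
    TrackShade c i j = ∃[ s ] ∃[ s' ] (Next w s s' ×
      InConf w s i × IsCounter c (w at i) × InConf w s' j × IsShadow c (w at j))

    Shade⇒TrackShade : ∀ {i j} → Shade w i j → Σ Counter λ c → TrackShade c i j
    Shade⇒TrackShade (inj₁ sh) = first , sh
    Shade⇒TrackShade (inj₂ sh) = second , sh

    TrackShade⇒Shade : ∀ c {i j} → TrackShade c i j → Shade w i j
    TrackShade⇒Shade first  sh = inj₁ sh
    TrackShade⇒Shade second sh = inj₂ sh

    Moves⇔apply : ∀ act {c h : Pos w} x X → toℕ h ≡ suc x + X → (isZero x ≡ true → act ≢ dec) →
      Moves w act c h ⇔ (toℕ c ≡ suc (apply act x) + X)
    Moves⇔apply keep x       X h≡ _  = mk⇔ (λ mv → trans mv h≡) (λ c≡ → trans c≡ (sym h≡))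
    Moves⇔apply inc x       X h≡ _  = mk⇔ (λ mv → trans mv (cong suc h≡)) (λ c≡ → trans c≡ (cong suc (sym h≡)))
    Moves⇔apply dec zero    X h≡ nz = ⊥-elim (nz refl refl)
    Moves⇔apply dec (suc x) X h≡ _  = mk⇔ (λ mv → suc-injective (trans mv h≡)) (λ c≡ → trans (cong suc c≡) (sym h≡))

Agree-isZero : ∀ {P : Set} b x → (P → x ≡ 0) → (x ≡ 0 → P) → Agree b P → b ≡ isZero x
Agree-isZero true  x       P⇒ _  p  = cong isZero (sym (P⇒ p))
Agree-isZero false zero    _  ⇒P ¬p = ⊥-elim (¬p (⇒P refl))
Agree-isZero false (suc x) _  _  _  = refl

isZero-Agree : ∀ {P : Set} x → (P → x ≡ 0) → (x ≡ 0 → P) → Agree (isZero x) P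
isZero-Agree zero    _  ⇒P    = ⇒P refl
isZero-Agree (suc x) P⇒ _  p = 0≢1+n (sym (P⇒ p))

-- mark π v j d is the mark, at offset d + 1 of block j, of a group whose
-- counter (of value v j in configuration j) is written in the blocks with
-- even j ≡ π: the counter at offset v j + 1, then plain symbols to the end
-- of the block when a shade starts there, and in the next block plain
-- symbols up to the shadow at the same offset.  No guard j < T is needed
-- because block T consists of its state only.

module Marks (T : ℕ) where

  counterSide shadowSide : (ℕ → ℕ) → ℕ → ℕ → Maybe Mark
  counterSide v j d =
    select (d ≟ v j) (just l) (select ((suc j <? T) ×-dec (v j <? d)) (just plain) nothing)
  shadowSide v zero    d = nothing
  shadowSide v (suc j) d = select (d ≟ v j) (just r) (select (d <? v j) (just plain) nothing)

  mark : Bool → (ℕ → ℕ) → ℕ → ℕ → Maybe Mark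
  mark π v j d = select (even j ≟ᵇ π) (counterSide v j d) (shadowSide v j d)

  data MarkCase (π : Bool) (v : ℕ → ℕ) (j d : ℕ) : Mark → Set where
    counter       : even j ≡ π → d ≡ v j → MarkCase π v j d l
    after-counter : even j ≡ π → suc j < T → v j < d → MarkCase π v j d plain
    shadow        : ∀ {j'} → j ≡ suc j' → even j' ≡ π → d ≡ v j' → MarkCase π v j d r
    before-shadow : ∀ {j'} → j ≡ suc j' → even j' ≡ π → d < v j' → MarkCase π v j d plain

  module _ {π : Bool} {v : ℕ → ℕ} where

    mark-case : ∀ {j d μ} → mark π v j d ≡ just μ → MarkCase π v j d μ
    mark-case {j} {d} e with select-view (even j ≟ᵇ π) e
    ... | inj₁ (ej , e') = counterSide-case ej e'
      where
      counterSide-case : ∀ {μ} → even j ≡ π → counterSide v j d ≡ just μ → MarkCase π v j d μ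
      counterSide-case ej e with select-view (d ≟ v j) e
      ... | inj₁ (d≡ , refl) = counter ej d≡
      ... | inj₂ (_ , e') with select-view ((suc j <? T) ×-dec (v j <? d)) e'
      ...   | inj₁ ((sj , vd) , refl) = after-counter ej sj vd
      ...   | inj₂ (_ , ())
    ... | inj₂ (nj , e') = shadowSide-case j nj e'
      where
      shadowSide-case : ∀ j {μ} → even j ≢ π → shadowSide v j d ≡ just μ → MarkCase π v j d μ
      shadowSide-case zero    _  ()
      shadowSide-case (suc j) nj e with select-view (d ≟ v j) e
      ... | inj₁ (d≡ , refl) = shadow refl (even-suc-≢⁻¹ j nj) d≡
      ... | inj₂ (_ , e') with select-view (d <? v j) e'
      ...   | inj₁ (dv , refl) = before-shadow refl (even-suc-≢⁻¹ j nj) dv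
      ...   | inj₂ (_ , ())

    mark-counter : ∀ {j d} → even j ≡ π → d ≡ v j → mark π v j d ≡ just l
    mark-counter {j} {d} ej d≡ = trans (select-yes (even j ≟ᵇ π) ej) (select-yes (d ≟ v j) d≡)

    mark-after-counter : ∀ {j d} → even j ≡ π → suc j < T → v j < d → mark π v j d ≡ just plain
    mark-after-counter {j} {d} ej sj vd = trans (select-yes (even j ≟ᵇ π) ej)
      (trans (select-no (d ≟ v j) (λ d≡ → <⇒≢ vd (sym d≡)))
             (select-yes ((suc j <? T) ×-dec (v j <? d)) (sj , vd)))

    mark-shadow : ∀ {j d} → even j ≡ π → d ≡ v j → mark π v (suc j) d ≡ just r
    mark-shadow {j} {d} ej d≡ =
      trans (select-no (even (suc j) ≟ᵇ π) (even-suc-≢ j ej)) (select-yes (d ≟ v j) d≡)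

    mark-before-shadow : ∀ {j d} → even j ≡ π → d < v j → mark π v (suc j) d ≡ just plain
    mark-before-shadow {j} {d} ej dv = trans (select-no (even (suc j) ≟ᵇ π) (even-suc-≢ j ej))
      (trans (select-no (d ≟ v j) (<⇒≢ dv)) (select-yes (d <? v j) dv))

-- From an accepting run to a uniform word

module FromRun {k : ℕ} (A : Automaton k) (det : Deterministic A) (nzd : NoZeroDecrement A)
  {C : MConf k} (run : Star (Step A) (q₀ A , 0 , 0) C) (final-C : proj₁ C ∈ final A) where

  T : ℕ
  T = steps run

  state : ℕ → Fin k
  state j = proj₁ (run ! j)

  count : Counter → ℕ → ℕ
  count c j = value c (run ! j)

  count-zero : ∀ c → count c 0 ≡ 0
  count-zero c = trans (cong (value c) (!-zero run)) (value-initial c)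

  count≤ : ∀ c j → j ≤ T → count c j ≤ j
  count≤ c zero    _   = ≤-reflexive (count-zero c)
  count≤ c (suc j) j<T = begin
    count c (suc j)                        ≡⟨ Step-value A σ c ⟩
    apply (action c (proj₁ σ)) (count c j) ≤⟨ apply≤suc (action c (proj₁ σ)) (count c j) ⟩
    suc (count c j)                        ≤⟨ s≤s (count≤ c j (<⇒≤ j<T)) ⟩
    suc j                                  ∎
    where
    open ≤-Reasoning
    σ = !-step run j j<T
    apply≤suc : ∀ act x → apply act x ≤ suc x
    apply≤suc dec  zero    = z≤n
    apply≤suc dec  (suc x) = ≤-trans (n≤1+n x) (n≤1+n (suc x))
    apply≤suc inc  x       = ≤-refl
    apply≤suc keep x       = n≤1+n x

  m : ℕ
  m = suc T

  open Blocks m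
  open Marks T

  count<m : ∀ c {j} → j < T → suc (count c j) < m
  count<m c {j} j<T = s≤s (≤-<-trans (count≤ c j (<⇒≤ j<T)) j<T)

  isUnprimed : Group → Bool
  isUnprimed F  = true
  isUnprimed F' = false
  isUnprimed S  = true
  isUnprimed S' = false

  counterOf : Group → Counter
  counterOf F  = first
  counterOf F' = first
  counterOf S  = second
  counterOf S' = second

  letter : ℕ → ℕ → Letter
  letter j d g = mark (isUnprimed g) (count (counterOf g)) j d

  letter-unprimed : ∀ c j d → letter j d (unprimed c) ≡ mark true (count c) j d
  letter-unprimed first  j d = refl
  letter-unprimed second j d = refl

  letter-primed : ∀ c j d → letter j d (primed c) ≡ mark false (count c) j d
  letter-primed first  j d = refl
  letter-primed second j d = refl

  stateSym : Bool → Fin k → Sym k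
  stateSym true  = st
  stateSym false = st'

  symbolAt : ℕ → ℕ → Sym k
  symbolAt j zero    = stateSym (even j) (state j)
  symbolAt j (suc d) = ns (letter j d)

  symbol : ℕ → Sym k
  symbol p = symbolAt (block p) (offset p)

  w : Word k
  w = applyUpTo symbol (suc (T * m))

  ∣w∣ : length w ≡ suc (T * m)
  ∣w∣ = length-applyUpTo symbol (suc (T * m))

  toℕ<∣w∣ : ∀ (i : Pos w) → toℕ i < suc (T * m)
  toℕ<∣w∣ i = subst (toℕ i <_) ∣w∣ (toℕ<n i)

  blk off : Pos w → ℕ
  blk i = block (toℕ i)
  off i = offset (toℕ i)

  cell : ∀ j o → pos j o < suc (T * m) → Pos w
  cell j o h = fromℕ< (subst (pos j o <_) (sym ∣w∣) h)

  module _ (j o : ℕ) (h : pos j o < suc (T * m)) where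

    toℕ-cell : toℕ (cell j o h) ≡ pos j o
    toℕ-cell = toℕ-fromℕ< _

    blk-cell : o < m → blk (cell j o h) ≡ j
    blk-cell o<m = trans (cong block toℕ-cell) (block-pos j o<m)

    off-cell : o < m → off (cell j o h) ≡ o
    off-cell o<m = trans (cong offset toℕ-cell) (offset-pos j o<m)

  0<m : 0 < m
  0<m = s≤s z≤n

  start<∣w∣ : ∀ {j} → j ≤ T → pos j 0 < suc (T * m)
  start<∣w∣ j≤T = s≤s (*-monoˡ-≤ m j≤T)

  inner<∣w∣ : ∀ {j o} → j < T → o < m → pos j o < suc (T * m)
  inner<∣w∣ {j} j<T o<m = ≤-trans (+-monoˡ-< (j * m) o<m) (≤-trans (*-monoˡ-≤ m j<T) (n≤1+n (T * m)))

  w-at : ∀ i → w at i ≡ symbol (toℕ i)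
  w-at i = lookup-applyUpTo symbol (suc (T * m)) i

  w-at-state : ∀ i → off i ≡ 0 → w at i ≡ stateSym (even (blk i)) (state (blk i))
  w-at-state i e = trans (w-at i) (cong (symbolAt (blk i)) e)

  w-at-letter : ∀ i {d} → off i ≡ suc d → w at i ≡ ns (letter (blk i) d)
  w-at-letter i e = trans (w-at i) (cong (symbolAt (blk i)) e)

  stateOf-stateSym : ∀ b q → stateOf (stateSym b q) ≡ just q
  stateOf-stateSym true  q = refl
  stateOf-stateSym false q = refl

  stateSym-isState : ∀ b q → IsState (stateSym b q)
  stateSym-isState true  q = tt
  stateSym-isState false q = tt

  stateSym-has : ∀ b q {g μ} → ¬ Has (stateSym b q) g μ
  stateSym-has true  q ()
  stateSym-has false q ()

  St⇒off≡0 : ∀ i → St w i → off i ≡ 0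
  St⇒off≡0 i h with off i in e
  ... | zero  = refl
  ... | suc d = ⊥-elim (subst IsState (w-at-letter i e) h)

  off≡0⇒St : ∀ i → off i ≡ 0 → St w i
  off≡0⇒St i e = subst IsState (sym (w-at-state i e)) (stateSym-isState _ _)

  has⇒ : ∀ i {g μ} → Has (w at i) g μ → ∃[ d ] (off i ≡ suc d × letter (blk i) d g ≡ just μ)
  has⇒ i {g} {μ} h with off i in e
  ... | zero  = ⊥-elim (stateSym-has _ _ (subst (λ x → Has x g μ) (w-at-state i e) h))
  ... | suc d = d , refl , subst (λ x → Has x g μ) (w-at-letter i e) h

  has⇐ : ∀ i {g μ d} → off i ≡ suc d → letter (blk i) d g ≡ just μ → Has (w at i) g μ
  has⇐ i {g} {μ} e h = subst (λ x → Has x g μ) (sym (w-at-letter i e)) h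

  has-case : ∀ i {g π v μ} → (∀ j d → letter j d g ≡ mark π v j d) → Has (w at i) g μ →
    ∃[ d ] (off i ≡ suc d × MarkCase π v (blk i) d μ)
  has-case i eq h with has⇒ i h
  ... | d , o , e = d , o , mark-case (trans (sym (eq (blk i) d)) e)

  blk≤T : ∀ i → blk i ≤ T
  blk≤T i = subst (blk i ≤_) (block-pos T 0<m) (block-mono (≤-pred (toℕ<∣w∣ i)))

  blk≡T⇒off≡0 : ∀ i → blk i ≡ T → off i ≡ 0
  blk≡T⇒off≡0 i e = n≤0⇒n≡0 (+-cancelʳ-≤ (T * m) (off i) 0
    (subst (_≤ T * m) (trans (offset+block (toℕ i)) (cong (λ j → pos j (off i)) e)) (≤-pred (toℕ<∣w∣ i))))

  letter⇒blk<T : ∀ i {d} → off i ≡ suc d → blk i < T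
  letter⇒blk<T i o = ≤∧≢⇒< (blk≤T i) (λ e → 0≢1+n (trans (sym (blk≡T⇒off≡0 i e)) o))

  start : ∀ j → j ≤ T → Pos w
  start j j≤T = cell j 0 (start<∣w∣ j≤T)

  blk-start : ∀ j (j≤T : j ≤ T) → blk (start j j≤T) ≡ j
  blk-start j j≤T = blk-cell j 0 (start<∣w∣ j≤T) 0<m

  off-start : ∀ j (j≤T : j ≤ T) → off (start j j≤T) ≡ 0
  off-start j j≤T = off-cell j 0 (start<∣w∣ j≤T) 0<m

  ¬St-in-block : ∀ {s j} → off s ≡ 0 → toℕ s < toℕ j → blk j ≡ blk s → ¬ St w j
  ¬St-in-block {s} {j} os s<j bj stj =
    <⇒≢ (offset-mono (sym bj) s<j) (trans os (sym (St⇒off≡0 j stj)))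

  state-between : ∀ (s i : Pos w) → blk s < blk i →
    ∃[ p ] (toℕ s < toℕ p × toℕ p ≤ toℕ i × St w p × blk p ≡ suc (blk s))
  state-between s i lt = p , s<p , p≤i , off≡0⇒St p (off-start _ j≤T) , blk-start _ j≤T
    where
    j≤T = ≤-trans lt (blk≤T i)
    p = start (suc (blk s)) j≤T
    s<p : toℕ s < toℕ p
    s<p = subst (toℕ s <_) (sym (toℕ-cell (suc (blk s)) 0 (start<∣w∣ j≤T))) (<next-block (toℕ s))
    p≤i : toℕ p ≤ toℕ i
    p≤i = subst (_≤ toℕ i) (sym (toℕ-cell (suc (blk s)) 0 (start<∣w∣ j≤T))) (≤-trans (*-monoˡ-≤ m lt) (block*m≤ (toℕ i)))

  InConf⇒ : ∀ {s i} → InConf w s i → off s ≡ 0 × blk i ≡ blk s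
  InConf⇒ {s} {i} (sts , s≤i , none) with blk s <? blk i
  ... | yes lt  = let (p , s<p , p≤i , stp , _) = state-between s i lt in ⊥-elim (none p s<p p≤i stp)
  ... | no ¬lt = St⇒off≡0 s sts , ≤-antisym (≮⇒≥ ¬lt) (block-mono s≤i)

  InConf⇐ : ∀ {s i} → off s ≡ 0 → blk i ≡ blk s → InConf w s i
  InConf⇐ {s} {i} os bi = off≡0⇒St s os ,
    subst (_≤ toℕ i) (sym (trans (offset≡0⇒ os) (cong (_* m) (sym bi)))) (block*m≤ (toℕ i)) ,
    λ j s<j j≤i → ¬St-in-block os s<j (≤-antisym (subst (blk j ≤_) bi (block-mono j≤i)) (block-mono (<⇒≤ s<j)))

  Next⇒ : ∀ {s s'} → Next w s s' → off s ≡ 0 × off s' ≡ 0 × blk s' ≡ suc (blk s)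
  Next⇒ {s} {s'} (sts , sts' , s<s' , none) = os , os' , ≤-antisym ≤suc suc≤
    where
    os = St⇒off≡0 s sts
    os' = St⇒off≡0 s' sts'
    suc≤ : suc (blk s) ≤ blk s'
    suc≤ = ≤∧≢⇒< (block-mono (<⇒≤ s<s'))
      (λ e → <⇒≢ s<s' (block-offset-injective e (trans os (sym os'))))
    ≤suc : blk s' ≤ suc (blk s)
    ≤suc with suc (blk s) <? blk s'
    ... | no ¬lt = ≮⇒≥ ¬lt
    ... | yes lt =
      let (p , s<p , p≤s' , stp , bp) = state-between s s' (≤-trans (n≤1+n _) lt) in
      ⊥-elim (none p s<p (≤∧≢⇒< p≤s' (λ e → <⇒≢ lt (trans (sym bp) (cong block e)))) stp)

  Next⇐ : ∀ {s s'} → off s ≡ 0 → off s' ≡ 0 → blk s' ≡ suc (blk s) → Next w s s'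
  Next⇐ {s} {s'} os os' e = off≡0⇒St s os , off≡0⇒St s' os' ,
    block<⇒< (subst (blk s <_) (sym e) (n<1+n _)) , none
    where
    none : ∀ j → toℕ s < toℕ j → toℕ j < toℕ s' → ¬ St w j
    none j s<j j<s' stj with m≤n⇒m<n∨m≡n (block-mono (<⇒≤ s<j))
    ... | inj₂ e₁ = ¬St-in-block os s<j (sym e₁) stj
    ... | inj₁ lt with m≤n⇒m<n∨m≡n (block-mono (<⇒≤ j<s'))
    ...   | inj₂ e₂ = ¬St-in-block (St⇒off≡0 j stj) j<s' (sym e₂) (off≡0⇒St s' os')
    ...   | inj₁ lt₂ = <⇒≱ lt₂ (subst (_≤ blk j) (sym e) lt)

  Last⇒ : ∀ {s} → IsLast w s → blk s ≡ T
  Last⇒ {s} (sts , none) with blk s <? T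
  ... | no ¬lt = ≤-antisym (blk≤T s) (≮⇒≥ ¬lt)
  ... | yes lt = let (p , s<p , _ , stp , _) = state-between s (start T ≤-refl)
                                                 (subst (blk s <_) (sym (blk-start T ≤-refl)) lt) in
                 ⊥-elim (none p s<p stp)

  Last⇐ : ∀ {s} → off s ≡ 0 → blk s ≡ T → IsLast w s
  Last⇐ {s} os e = off≡0⇒St s os , λ j s<j _ →
    <⇒≱ s<j (subst (toℕ j ≤_) (sym (trans (offset≡0⇒ os) (cong (_* m) e))) (≤-pred (toℕ<∣w∣ j)))

  notLast⇒blk<T : ∀ {s} → St w s → ¬ IsLast w s → blk s < T
  notLast⇒blk<T {s} sts nl = ≤∧≢⇒< (blk≤T s) (λ e → nl (Last⇐ (St⇒off≡0 s sts) e))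

  First⇒ : ∀ {s} → IsFirst w s → blk s ≡ 0
  First⇒ e = trans (cong block e) (block-pos 0 0<m)

  First⇐ : ∀ {s} → off s ≡ 0 → blk s ≡ 0 → IsFirst w s
  First⇐ os e = trans (offset≡0⇒ os) (cong (_* m) e)

  state-kind : ∀ s → off s ≡ 0 →
    (even (blk s) ≡ true × EvenState (w at s)) ⊎ (even (blk s) ≡ false × OddState (w at s))
  state-kind s os with even (blk s) in e
  ... | true  = inj₁ (refl , state (blk s) , trans (w-at-state s os) (cong (λ b → stateSym b (state (blk s))) e))
  ... | false = inj₂ (refl , state (blk s) , trans (w-at-state s os) (cong (λ b → stateSym b (state (blk s))) e))

  EvenState⇒ : ∀ s → off s ≡ 0 → EvenState (w at s) → even (blk s) ≡ true
  EvenState⇒ s os (q , e) with state-kind s os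
  ... | inj₁ (ev , _) = ev
  ... | inj₂ (_ , q' , e') with trans (sym e) e'
  ...   | ()

  OddState⇒ : ∀ s → off s ≡ 0 → OddState (w at s) → even (blk s) ≡ false
  OddState⇒ s os (q , e) with state-kind s os
  ... | inj₂ (od , _) = od
  ... | inj₁ (_ , q' , e') with trans (sym e) e'
  ...   | ()

  stateOf-w : ∀ s → off s ≡ 0 → stateOf (w at s) ≡ just (state (blk s))
  stateOf-w s os = trans (cong stateOf (w-at-state s os)) (stateOf-stateSym _ _)

  blk-off-injective : ∀ {i i'} → blk i ≡ blk i' → off i ≡ off i' → i ≡ i'
  blk-off-injective eb eo = toℕ-injective (block-offset-injective eb eo)

  toℕ≡blk-off : ∀ {i j o} → blk i ≡ j → off i ≡ o → toℕ i ≡ pos j o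
  toℕ≡blk-off {i} eb eo = trans (offset+block (toℕ i)) (cong₂ pos eb eo)

  module Track (c : Counter) where

    v : ℕ → ℕ
    v = count c

    unprimed-case : ∀ i {μ} → Has (w at i) (unprimed c) μ → ∃[ d ] (off i ≡ suc d × MarkCase true v (blk i) d μ)
    unprimed-case i = has-case i (letter-unprimed c)

    primed-case : ∀ i {μ} → Has (w at i) (primed c) μ → ∃[ d ] (off i ≡ suc d × MarkCase false v (blk i) d μ)
    primed-case i = has-case i (letter-primed c)

    counter⇒ : ∀ i → IsCounter c (w at i) → off i ≡ suc (v (blk i))
    counter⇒ i (inj₁ h) with unprimed-case i h
    ... | _ , o , counter _ d≡ = trans o (cong suc d≡)
    counter⇒ i (inj₂ h) with primed-case i h
    ... | _ , o , counter _ d≡ = trans o (cong suc d≡)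

    counter⇐ : ∀ i → off i ≡ suc (v (blk i)) → IsCounter c (w at i)
    counter⇐ i o with even (blk i) in e
    ... | true  = inj₁ (has⇐ i o (trans (letter-unprimed c (blk i) _) (mark-counter {v = v} {j = blk i} e refl)))
    ... | false = inj₂ (has⇐ i o (trans (letter-primed c (blk i) _) (mark-counter {v = v} {j = blk i} e refl)))

    shadow⇒ : ∀ i → IsShadow c (w at i) → ∃[ j ] (blk i ≡ suc j × off i ≡ suc (v j))
    shadow⇒ i (inj₁ h) with unprimed-case i h
    ... | _ , o , shadow b _ d≡ = _ , b , trans o (cong suc d≡)
    shadow⇒ i (inj₂ h) with primed-case i h
    ... | _ , o , shadow b _ d≡ = _ , b , trans o (cong suc d≡)

    shadow⇐ : ∀ i j → blk i ≡ suc j → off i ≡ suc (v j) → IsShadow c (w at i)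
    shadow⇐ i j b o with even j in e
    ... | true  = inj₁ (has⇐ i o (trans (letter-unprimed c (blk i) (v j))
                    (subst (λ z → mark true v z (v j) ≡ just r) (sym b) (mark-shadow {v = v} {j = j} e refl))))
    ... | false = inj₂ (has⇐ i o (trans (letter-primed c (blk i) (v j))
                    (subst (λ z → mark false v z (v j) ≡ just r) (sym b) (mark-shadow {v = v} {j = j} e refl))))

    counter-unprimed : ∀ i → IsCounter c (w at i) → even (blk i) ≡ true → Has (w at i) (unprimed c) l
    counter-unprimed i (inj₁ h) _ = h
    counter-unprimed i (inj₂ h) e with primed-case i h
    ... | _ , _ , counter od _ with trans (sym e) od
    ...   | ()

    counter-primed : ∀ i → IsCounter c (w at i) → even (blk i) ≡ false → Has (w at i) (primed c) l
    counter-primed i (inj₂ h) _ = h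
    counter-primed i (inj₁ h) e with unprimed-case i h
    ... | _ , _ , counter ev _ with trans (sym e) ev
    ...   | ()

    shadow-unprimed : ∀ i → IsShadow c (w at i) → even (blk i) ≡ false → Has (w at i) (unprimed c) r
    shadow-unprimed i (inj₁ h) _ = h
    shadow-unprimed i (inj₂ h) e with primed-case i h
    ... | _ , _ , shadow b od _ with trans (sym e) (trans (cong even b) (cong not od))
    ...   | ()

    shadow-primed : ∀ i → IsShadow c (w at i) → even (blk i) ≡ true → Has (w at i) (primed c) r
    shadow-primed i (inj₂ h) _ = h
    shadow-primed i (inj₁ h) e with unprimed-case i h
    ... | _ , _ , shadow b ev _ with trans (sym e) (trans (cong even b) (cong not ev))
    ...   | ()

    counter-parity : ∀ s i → InConf w s i → IsCounter c (w at i) →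
      (EvenState (w at s) → Has (w at i) (unprimed c) l) × (OddState (w at s) → Has (w at i) (primed c) l)
    counter-parity s i ic ci = let (os , bi) = InConf⇒ ic in
      (λ es → counter-unprimed i ci (trans (cong even bi) (EvenState⇒ s os es))) ,
      (λ od → counter-primed i ci (trans (cong even bi) (OddState⇒ s os od)))

    shadow-parity : ∀ s i → InConf w s i → IsShadow c (w at i) →
      (EvenState (w at s) → Has (w at i) (primed c) r) × (OddState (w at s) → Has (w at i) (unprimed c) r)
    shadow-parity s i ic si = let (os , bi) = InConf⇒ ic in
      (λ es → shadow-primed i si (trans (cong even bi) (EvenState⇒ s os es))) ,
      (λ od → shadow-unprimed i si (trans (cong even bi) (OddState⇒ s os od)))

    counterCell : ∀ j → j < T → Pos w
    counterCell j j<T = cell j (suc (v j)) (inner<∣w∣ j<T (count<m c j<T))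

    blk-counterCell : ∀ j (j<T : j < T) → blk (counterCell j j<T) ≡ j
    blk-counterCell j j<T = blk-cell j (suc (v j)) (inner<∣w∣ j<T (count<m c j<T)) (count<m c j<T)

    off-counterCell : ∀ j (j<T : j < T) → off (counterCell j j<T) ≡ suc (v j)
    off-counterCell j j<T = off-cell j (suc (v j)) (inner<∣w∣ j<T (count<m c j<T)) (count<m c j<T)

    toℕ-counterCell : ∀ j (j<T : j < T) → toℕ (counterCell j j<T) ≡ pos j (suc (v j))
    toℕ-counterCell j j<T = toℕ-cell j (suc (v j)) (inner<∣w∣ j<T (count<m c j<T))

    shadowCell : ∀ j → suc j < T → Pos w
    shadowCell j sj<T = cell (suc j) (suc (v j)) (inner<∣w∣ sj<T (count<m c (<-trans (n<1+n j) sj<T)))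

    blk-shadowCell : ∀ j (sj<T : suc j < T) → blk (shadowCell j sj<T) ≡ suc j
    blk-shadowCell j sj<T = blk-cell (suc j) (suc (v j)) (inner<∣w∣ sj<T v<m) v<m
      where v<m = count<m c (<-trans (n<1+n j) sj<T)

    off-shadowCell : ∀ j (sj<T : suc j < T) → off (shadowCell j sj<T) ≡ suc (v j)
    off-shadowCell j sj<T = off-cell (suc j) (suc (v j)) (inner<∣w∣ sj<T v<m) v<m
      where v<m = count<m c (<-trans (n<1+n j) sj<T)

    toℕ-shadowCell : ∀ j (sj<T : suc j < T) → toℕ (shadowCell j sj<T) ≡ pos (suc j) (suc (v j))
    toℕ-shadowCell j sj<T = toℕ-cell (suc j) (suc (v j)) (inner<∣w∣ sj<T (count<m c (<-trans (n<1+n j) sj<T)))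

    exactlyOne-counter : ∀ s → St w s → ¬ IsLast w s → ExactlyOne w s (IsCounter c)
    exactlyOne-counter s sts nl =
      i , (InConf⇐ os bi , counter⇐ i (trans oi (cong (suc ∘ v) (sym bi)))) , unique
      where
      os = St⇒off≡0 s sts
      j<T = notLast⇒blk<T sts nl
      i = counterCell (blk s) j<T
      bi = blk-counterCell (blk s) j<T
      oi = off-counterCell (blk s) j<T
      unique : ∀ i' → InConf w s i' → IsCounter c (w at i') → i' ≡ i
      unique i' ic ci' = let (_ , bi') = InConf⇒ ic in
        blk-off-injective (trans bi' (sym bi)) (trans (counter⇒ i' ci') (trans (cong (suc ∘ v) bi') (sym oi)))

    exactlyOne-shadow : ∀ s → St w s → ¬ IsFirst w s → ¬ IsLast w s → ExactlyOne w s (IsShadow c)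
    exactlyOne-shadow s sts nf nl with blk s in e
    ... | zero  = ⊥-elim (nf (First⇐ (St⇒off≡0 s sts) e))
    ... | suc j = i , (InConf⇐ os (trans bi (sym e)) , shadow⇐ i j bi oi) , unique
      where
      os = St⇒off≡0 s sts
      sj<T = subst (_< T) e (notLast⇒blk<T sts nl)
      i = shadowCell j sj<T
      bi = blk-shadowCell j sj<T
      oi = off-shadowCell j sj<T
      unique : ∀ i' → InConf w s i' → IsShadow c (w at i') → i' ≡ i
      unique i' ic si' = let (_ , bi') = InConf⇒ ic ; (j' , bj' , oj') = shadow⇒ i' si' in
        blk-off-injective (trans bi' (trans e (sym bi)))
          (trans oj' (trans (cong (suc ∘ v) (suc-injective (trans (sym bj') (trans bi' e)))) (sym oi)))

    no-shadow : ∀ s → IsFirst w s ⊎ IsLast w s → NoneIn w s (IsShadow c)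
    no-shadow s (inj₁ fs) i ic si =
      let (_ , bi) = InConf⇒ ic ; (_ , bj , _) = shadow⇒ i si in
      0≢1+n (trans (sym (First⇒ fs)) (trans (sym bi) bj))
    no-shadow s (inj₂ ls) i ic si =
      let (_ , bi) = InConf⇒ ic ; (_ , _ , o) = shadow⇒ i si in
      <-irrefl (trans bi (Last⇒ ls)) (letter⇒blk<T i o)

    trackShade⇒ : ∀ {a b} → TrackShade w c a b → off b ≡ off a × blk b ≡ suc (blk a)
    trackShade⇒ {a} {b} (_ , _ , nx , ia , ca , ib , sb) =
      trans ob (trans (cong (suc ∘ v) j≡) (sym (counter⇒ a ca))) , bb
      where
      bs' = proj₂ (proj₂ (Next⇒ nx))
      bb : blk b ≡ suc (blk a)
      bb = trans (proj₂ (InConf⇒ ib)) (trans bs' (cong suc (sym (proj₂ (InConf⇒ ia)))))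
      j = proj₁ (shadow⇒ b sb)
      ob = proj₂ (proj₂ (shadow⇒ b sb))
      j≡ : j ≡ blk a
      j≡ = suc-injective (trans (sym (proj₁ (proj₂ (shadow⇒ b sb)))) bb)

    canonical-shade : ∀ j (sj<T : suc j < T) →
      TrackShade w c (counterCell j (<-trans (n<1+n j) sj<T)) (shadowCell j sj<T)
    canonical-shade j sj<T =
      s₀ , s₁ ,
      Next⇐ (off-start j j≤T) (off-start (suc j) sj≤T) (trans (blk-start (suc j) sj≤T) (cong suc (sym (blk-start j j≤T)))) ,
      InConf⇐ (off-start j j≤T) (trans (blk-counterCell j j<T) (sym (blk-start j j≤T))) ,
      counter⇐ a (trans (off-counterCell j j<T) (cong (suc ∘ v) (sym (blk-counterCell j j<T)))) ,
      InConf⇐ (off-start (suc j) sj≤T) (trans (blk-shadowCell j sj<T) (sym (blk-start (suc j) sj≤T))) ,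
      shadow⇐ (shadowCell j sj<T) j (blk-shadowCell j sj<T) (off-shadowCell j sj<T)
      where
      j<T = <-trans (n<1+n j) sj<T
      j≤T = <⇒≤ j<T
      sj≤T = <⇒≤ sj<T
      s₀ = start j j≤T
      s₁ = start (suc j) sj≤T
      a = counterCell j j<T

    counter-at-1 : ∀ i → toℕ i ≡ 1 → IsCounter c (w at i)
    counter-at-1 i i≡1 =
      counter⇐ i (trans (cong offset i≡) (trans (offset-pos 0 1<m) (cong suc (sym (trans (cong v bi) (count-zero c))))))
      where
      1<m : 1 < m
      1<m = s≤s (n≢0⇒n>0 λ T≡0 → <-irrefl refl
              (subst (λ t → 1 < suc (t * m)) T≡0 (subst (_< suc (T * m)) i≡1 (toℕ<∣w∣ i))))
      i≡ : toℕ i ≡ pos 0 1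
      i≡ = i≡1
      bi : blk i ≡ 0
      bi = trans (cong block i≡) (block-pos 0 1<m)

    counterZero⇔ : ∀ s → off s ≡ 0 → blk s < T → CounterZero w c s ⇔ (v (blk s) ≡ 0)
    counterZero⇔ s os j<T = mk⇔ zero⇒ zero⇐
      where
      1<m : 1 < m
      1<m = s≤s (≤-<-trans z≤n j<T)
      next : ∀ {i} → toℕ i ≡ suc (toℕ s) → toℕ i ≡ pos (blk s) 1
      next ti = trans ti (cong suc (offset≡0⇒ os))
      zero⇒ : CounterZero w c s → v (blk s) ≡ 0
      zero⇒ (i , ti , ci) =
        let bi = trans (cong block (next ti)) (block-pos (blk s) 1<m)
            oi = trans (cong offset (next ti)) (offset-pos (blk s) 1<m)
        in trans (cong v (sym bi)) (sym (suc-injective (trans (sym oi) (counter⇒ i ci))))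
      zero⇐ : v (blk s) ≡ 0 → CounterZero w c s
      zero⇐ e = i , trans (toℕ-cell (blk s) 1 h) (cong suc (sym (offset≡0⇒ os))) ,
                counter⇐ i (trans oi (cong suc (sym (trans (cong v bi) e))))
        where
        h = inner<∣w∣ j<T 1<m
        i = cell (blk s) 1 h
        bi = blk-cell (blk s) 1 h 1<m
        oi = off-cell (blk s) 1 h 1<m

    moves : ∀ {s s'} act → Next w s s' → v (suc (blk s)) ≡ apply act (v (blk s)) →
      (isZero (v (blk s)) ≡ true → act ≢ dec) →
      ∀ x h → InConf w s' x → IsCounter c (w at x) → InConf w s' h → IsShadow c (w at h) → Moves w act x h
    moves {s} act nx step nz x h ix cx ih sh =
      Equivalence.from (Moves⇔apply w act (v (blk s)) (suc (blk s) * m) h≡ nz) x≡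
      where
      bs' = proj₂ (proj₂ (Next⇒ nx))
      bx = trans (proj₂ (InConf⇒ ix)) bs'
      bh = trans (proj₂ (InConf⇒ ih)) bs'
      j'≡ : proj₁ (shadow⇒ h sh) ≡ blk s
      j'≡ = suc-injective (trans (sym (proj₁ (proj₂ (shadow⇒ h sh)))) bh)
      h≡ : toℕ h ≡ suc (v (blk s)) + suc (blk s) * m
      h≡ = toℕ≡blk-off bh (trans (proj₂ (proj₂ (shadow⇒ h sh))) (cong (suc ∘ v) j'≡))
      x≡ : toℕ x ≡ suc (apply act (v (blk s))) + suc (blk s) * m
      x≡ = toℕ≡blk-off bx (trans (counter⇒ x cx) (cong suc (trans (cong v bx) step)))

  module First  = Track first
  module Second = Track second

  shade⇒ : ∀ {a b} → Shade w a b → off b ≡ off a × blk b ≡ suc (blk a)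
  shade⇒ sh = let (c , tsh) = Shade⇒TrackShade w sh in Track.trackShade⇒ c tsh

  toℕ-next-block : ∀ {a b} → off b ≡ off a → blk b ≡ suc (blk a) → toℕ b ≡ m + toℕ a
  toℕ-next-block {a} {b} ob bb = begin
    toℕ b                          ≡⟨ toℕ≡blk-off bb ob ⟩
    off a + (m + blk a * m)        ≡⟨ sym (+-assoc (off a) m _) ⟩
    off a + m + blk a * m          ≡⟨ cong (_+ blk a * m) (+-comm (off a) m) ⟩
    m + off a + blk a * m          ≡⟨ +-assoc m (off a) _ ⟩
    m + (off a + blk a * m)        ≡⟨ cong (m +_) (sym (offset+block (toℕ a))) ⟩
    m + toℕ a                      ∎
    where open ≡-Reasoning

  uniform : Uniform w (suc m)
  uniform = config-length , shade-length
    where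
    config-length : ∀ s s' → Next w s s' → toℕ s' ∸ toℕ s ≡ m
    config-length s s' nx = let (os , os' , bs') = Next⇒ nx in
      trans (cong (_∸ toℕ s) (toℕ-next-block (trans os' (sym os)) bs')) (m+n∸n≡m m (toℕ s))
    shade-length : ∀ a b → Shade w a b → suc (toℕ b ∸ toℕ a) ≡ suc m
    shade-length a b sh = let (ob , bb) = shade⇒ sh in
      cong suc (trans (cong (_∸ toℕ a) (toℕ-next-block ob bb)) (m+n∸n≡m m (toℕ a)))

  cond1 : Cond1 A w
  cond1 = (applyUpTo (symbol ∘ suc) (T * m) , cong (λ q → st q ∷ applyUpTo (symbol ∘ suc) (T * m)) state-zero) ,
          (applyUpTo symbol (T * m) , symbol (T * m) , sym (applyUpTo-∷ʳ symbol (T * m)) ,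
           proj₁ C , final-C , last-state)
    where
    state-zero : state 0 ≡ q₀ A
    state-zero = cong proj₁ (!-zero run)
    last≡ : ∀ {b} → even T ≡ b → symbol (T * m) ≡ stateSym b (proj₁ C)
    last≡ e = trans (cong₂ symbolAt (block-pos T 0<m) (offset-pos T 0<m))
                    (cong₂ stateSym e (cong proj₁ (!-steps run)))
    last-state : symbol (T * m) ≡ st (proj₁ C) ⊎ symbol (T * m) ≡ st' (proj₁ C)
    last-state with even T in e
    ... | true  = inj₁ (last≡ e)
    ... | false = inj₂ (last≡ e)

  cond2 : Cond2 A w
  cond2 s s' nx with Next⇒ nx
  ... | os , os' , bs' with state-kind s os | state-kind s' os'
  ... | inj₁ (_ , es) | inj₂ (_ , od) = inj₁ (es , od)
  ... | inj₂ (_ , od) | inj₁ (_ , es) = inj₂ (od , es)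
  ... | inj₁ (e , _)  | inj₁ (e' , _) = ⊥-elim (even-suc-≢ (blk s) e (trans (cong even (sym bs')) e'))
  ... | inj₂ (e , _)  | inj₂ (e' , _) = ⊥-elim (even-suc-≢ (blk s) e (trans (cong even (sym bs')) e'))

  cond3 : Cond3 A w
  cond3 = (λ s sts nl → First.exactlyOne-counter s sts nl , Second.exactlyOne-counter s sts nl ,
                        First.counter-parity s , Second.counter-parity s) ,
          (λ i i≡1 _ → First.counter-at-1 i i≡1 , Second.counter-at-1 i i≡1)

  cond4 : Cond4 A w
  cond4 = (λ s _ fl → First.no-shadow s fl , Second.no-shadow s fl) ,
          (λ s sts nf nl → First.exactlyOne-shadow s sts nf nl , Second.exactlyOne-shadow s sts nf nl ,
                           First.shadow-parity s , Second.shadow-parity s)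

  ¬St⇒letter : ∀ i → ¬ St w i → ∃[ d ] (off i ≡ suc d)
  ¬St⇒letter i ¬st with off i in e
  ... | zero  = ⊥-elim (¬st (off≡0⇒St i e))
  ... | suc d = d , refl

  cond5 : Cond5 A w
  cond5 g i ¬st = plain⇒shade , shade⇒plain
    where
    open Track (counterOf g)
    π = isUnprimed g

    has-counter : ∀ j (j<T : j < T) → even j ≡ π → Has (w at counterCell j j<T) g l
    has-counter j j<T ej = has⇐ (counterCell j j<T) {d = v j} (off-counterCell j j<T)
      (mark-counter {π} {v} {blk (counterCell j j<T)} (trans (cong even (blk-counterCell j j<T)) ej) (cong v (sym (blk-counterCell j j<T))))

    plain⇒shade : Has (w at i) g plain →
      ∃[ a ] ∃[ b ] (Shade w a b × toℕ a < toℕ i × toℕ i < toℕ b × Has (w at a) g l)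
    plain⇒shade h with has-case i (λ _ _ → refl) h
    ... | d , oi , after-counter ej sj vd =
      counterCell j j<T , shadowCell j sj , TrackShade⇒Shade w (counterOf g) (canonical-shade j sj) ,
      subst₂ _<_ (sym (toℕ-counterCell j j<T)) (sym (toℕ≡blk-off refl oi)) (+-monoˡ-< (j * m) (s≤s vd)) ,
      subst (toℕ i <_) (sym (toℕ-shadowCell j sj)) (≤-trans (<next-block (toℕ i)) (m≤n+m (suc j * m) (suc (v j)))) ,
      has-counter j j<T ej
      where
      j = blk i
      j<T = <-trans (n<1+n j) sj
    ... | d , oi , before-shadow {j} bi ej dv =
      counterCell j j<T , shadowCell j sj , TrackShade⇒Shade w (counterOf g) (canonical-shade j sj) ,
      subst (_< toℕ i) (sym (toℕ-counterCell j j<T))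
        (<-≤-trans (+-monoˡ-< (j * m) (count<m (counterOf g) j<T))
                   (subst (_≤ toℕ i) (cong (_* m) bi) (block*m≤ (toℕ i)))) ,
      subst₂ _<_ (sym (toℕ≡blk-off bi oi)) (sym (toℕ-shadowCell j sj)) (+-monoˡ-< (suc j * m) (s≤s dv)) ,
      has-counter j j<T ej
      where
      sj = subst (_< T) bi (letter⇒blk<T i oi)
      j<T = <-trans (n<1+n j) sj

    shade⇒plain : ∃[ a ] ∃[ b ] (Shade w a b × toℕ a < toℕ i × toℕ i < toℕ b × Has (w at a) g l) →
      Has (w at i) g plain
    shade⇒plain (a , b , sh , a<i , i<b , ha) with has-case a (λ _ _ → refl) ha | ¬St⇒letter i ¬st
    ... | e , oa , counter ej e≡ | d , oi with m≤n⇒m<n∨m≡n (block-mono (<⇒≤ a<i))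
    ...   | inj₂ ba = has⇐ i oi (mark-after-counter {π} {v} {blk i} (trans (cong even (sym ba)) ej) (subst (λ j → suc j < T) ba sj)
                        (subst (λ j → v j < d) ba (subst (_< d) e≡ (≤-pred (subst₂ _<_ oa oi (offset-mono ba a<i))))))
      where
      ob = proj₁ (shade⇒ sh)
      sj = subst (_< T) (proj₂ (shade⇒ sh)) (letter⇒blk<T b (trans ob oa))
    ...   | inj₁ lt = has⇐ i oi (subst (λ j → mark π v j d ≡ just plain) (sym bi)
                        (mark-before-shadow {π} {v} {blk a} ej (subst (d <_) e≡ (≤-pred (subst₂ _<_ oi (trans ob oa) (offset-mono (trans bi (sym bb)) i<b))))))
      where
      ob = proj₁ (shade⇒ sh)
      bb = proj₂ (shade⇒ sh)
      bi : blk i ≡ suc (blk a)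
      bi = ≤-antisym (subst (blk i ≤_) bb (block-mono (<⇒≤ i<b))) lt

  -- By determinism, an instruction matching configuration s is the one the run executes there.
  matching-step : ∀ {s s'} → Next w s s' → ∀ I → I LM.∈ instrs A → MatchesAssumption A w s I →
    to I ≡ state (suc (blk s)) ×
    (∀ c → count c (suc (blk s)) ≡ apply (action c I) (count c (blk s))) ×
    (∀ c → isZero (count c (blk s)) ≡ true → action c I ≢ dec)
  matching-step {s} {s'} nx I I∈ (st≡ , agree₁ , agree₂) =
    trans (cong to I≡I₀) (Step-to A σ) ,
    (λ c → trans (Step-value A σ c) (cong (λ J → apply (action c J) (count c j)) (sym I≡I₀))) ,
    (λ c z → NoZeroDecrement-at A nzd I∈ c (trans (zeroTest-I c) z))
    where
    os = proj₁ (Next⇒ nx)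
    j = blk s
    j<T : j < T
    j<T = subst (_≤ T) (proj₂ (proj₂ (Next⇒ nx))) (blk≤T s')
    σ = !-step run j j<T
    agrees : ∀ c → Agree (zeroTest c I) (CounterZero w c s)
    agrees first  = agree₁
    agrees second = agree₂
    zeroTest-I : ∀ c → zeroTest c I ≡ isZero (count c j)
    zeroTest-I c = let zero⇔ = Track.counterZero⇔ c s os j<T in
      Agree-isZero (zeroTest c I) (count c j) (Equivalence.to zero⇔) (Equivalence.from zero⇔) (agrees c)
    I≡I₀ : I ≡ proj₁ σ
    I≡I₀ = det I (proj₁ σ) I∈ (proj₁ (proj₂ σ))
      (trans (just-injective (trans (sym st≡) (stateOf-w s os))) (sym (Step-from A σ)))
      (trans (zeroTest-I first) (sym (Step-zeroTest A σ first)))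
      (trans (zeroTest-I second) (sym (Step-zeroTest A σ second)))

  cond6 : Cond6 A w
  cond6 s s' nx I I∈ match =
    trans (stateOf-w s' os') (cong just (trans (cong state bs') (sym to≡))) ,
    First.moves (act₁ I) nx (counts first) (no-dec first) ,
    Second.moves (act₂ I) nx (counts second) (no-dec second)
    where
    os' = proj₁ (proj₂ (Next⇒ nx))
    bs' = proj₂ (proj₂ (Next⇒ nx))
    to≡ = proj₁ (matching-step nx I I∈ match)
    counts = proj₁ (proj₂ (matching-step nx I I∈ match))
    no-dec = proj₂ (proj₂ (matching-step nx I I∈ match))

  inL : InL A w
  inL = cond1 , cond2 , cond3 , cond4 , cond5 , cond6

-- From a uniform word to an accepting run

least-after : ∀ {P : ℕ → Set} → (∀ t → Dec (P t)) → ∀ {s j} → s < j → P j →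
  ∃[ t ] (s < t × P t × ∀ t' → s < t' → t' < t → ¬ P t')
least-after {P} P? {s} {j} s<j pj =
  scan (j ∸ suc s) (suc s) ≤-refl (λ t' s<t' t'<t → ⊥-elim (<⇒≱ s<t' (≤-pred t'<t)))
       (subst P (sym (m+[n∸m]≡n s<j)) pj)
  where
  scan : ∀ g t → s < t → (∀ t' → s < t' → t' < t → ¬ P t') → P (t + g) →
    ∃[ t* ] (s < t* × P t* × ∀ t' → s < t' → t' < t* → ¬ P t')
  scan g t s<t none p with P? t
  ... | yes pt = t , s<t , pt , none
  scan zero    t s<t none p | no ¬pt = ⊥-elim (¬pt (subst P (+-identityʳ t) p))
  scan (suc g) t s<t none p | no ¬pt = scan g (suc t) (m<n⇒m<1+n s<t) none' (subst P (+-suc t g) p)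
    where
    none' : ∀ t' → s < t' → t' < suc t → ¬ P t'
    none' t' s<t' t'<st with m≤n⇒m<n∨m≡n (≤-pred t'<st)
    ... | inj₁ t'<t  = none t' s<t' t'<t
    ... | inj₂ refl = ¬pt

equal-gaps : ∀ {i h s s'} x → i ≤ h → s ≤ s' → h ∸ i ≡ s' ∸ s → i ≡ x + s → h ≡ x + s'
equal-gaps {i} {h} {s} {s'} x i≤h s≤s' gap i≡ = begin
  h                  ≡⟨ sym (m+[n∸m]≡n i≤h) ⟩
  i + (h ∸ i)        ≡⟨ cong₂ _+_ i≡ gap ⟩
  x + s + (s' ∸ s)   ≡⟨ +-assoc x s (s' ∸ s) ⟩
  x + (s + (s' ∸ s)) ≡⟨ cong (x +_) (m+[n∸m]≡n s≤s') ⟩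
  x + s'             ∎
  where open ≡-Reasoning

module _ {k : ℕ} where

  isState? : (x : Sym k) → Dec (IsState x)
  isState? (st _)  = yes tt
  isState? (st' _) = yes tt
  isState? (ns _)  = no λ ()

  first-position : (w : Word k) {x : Sym k} → ∃[ u ] (w ≡ x ∷ u) → Σ (Pos w) λ p → toℕ p ≡ 0 × w at p ≡ x
  first-position _ (_ , refl) = fzero , refl , refl

  final-position : (A : Automaton k) (w : Word k) → ∃[ u ] ∃[ x ] (w ≡ u ∷ʳ x × FinalSym A w x) →
    Σ (Pos w) λ p → FinalSym A w (w at p) × (∀ (i : Pos w) → toℕ i ≤ toℕ p)
  final-position A _ (u , x , refl , fin) =
    let (p , at-p , max) = go u in p , subst (FinalSym A (u ∷ʳ x)) (sym at-p) fin , max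
    where
    go : ∀ u → Σ (Pos (u ∷ʳ x)) λ p → (u ∷ʳ x) at p ≡ x × (∀ (i : Pos (u ∷ʳ x)) → toℕ i ≤ toℕ p)
    go []      = fzero , refl , λ { fzero → z≤n }
    go (y ∷ u) = let (p , at-p , max) = go u in
      fsuc p , at-p , λ { fzero → z≤n ; (fsuc i) → s≤s (max i) }

  InConf-prefix : ∀ (w : Word k) {s i i₀} → InConf w s i₀ → toℕ s ≤ toℕ i → toℕ i ≤ toℕ i₀ → InConf w s i
  InConf-prefix _ (sts , _ , none) s≤i i≤i₀ = sts , s≤i , λ j s<j j≤i → none j s<j (≤-trans j≤i i≤i₀)

  InConf<Next : ∀ (w : Word k) {s s' i} → Next w s s' → InConf w s i → toℕ i < toℕ s'
  InConf<Next _ (_ , sts' , s<s' , _) (_ , _ , none) = ≰⇒> λ s'≤i → none _ s<s' s'≤i sts'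

module ToRun {k : ℕ} (A : Automaton k) (complete : Complete A) (nzd : NoZeroDecrement A)
  (w : Word k) {n : ℕ} (cond1 : Cond1 A w) (cond3 : Cond3 A w) (cond4 : Cond4 A w) (cond6 : Cond6 A w)
  (uniform : Uniform w n) where

  exactlyOne-counter : ∀ c s → St w s → ¬ IsLast w s → ExactlyOne w s (IsCounter c)
  exactlyOne-counter first  s sts nl = proj₁ (proj₁ cond3 s sts nl)
  exactlyOne-counter second s sts nl = proj₁ (proj₂ (proj₁ cond3 s sts nl))

  exactlyOne-shadow : ∀ c s → St w s → ¬ IsFirst w s → ¬ IsLast w s → ExactlyOne w s (IsShadow c)
  exactlyOne-shadow first  s sts nf nl = proj₁ (proj₂ cond4 s sts nf nl)
  exactlyOne-shadow second s sts nf nl = proj₁ (proj₂ (proj₂ cond4 s sts nf nl))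

  counter-at-1 : ∀ c i → toℕ i ≡ 1 → ¬ St w i → IsCounter c (w at i)
  counter-at-1 first  i i≡1 ¬st = proj₁ (proj₂ cond3 i i≡1 ¬st)
  counter-at-1 second i i≡1 ¬st = proj₂ (proj₂ cond3 i i≡1 ¬st)

  moves : ∀ {s s'} → Next w s s' → ∀ I → I LM.∈ instrs A → MatchesAssumption A w s I →
    ∀ c x h → InConf w s' x → IsCounter c (w at x) → InConf w s' h → IsShadow c (w at h) → Moves w (action c I) x h
  moves nx I I∈ match first  = proj₁ (proj₂ (cond6 _ _ nx I I∈ match))
  moves nx I I∈ match second = proj₂ (proj₂ (cond6 _ _ nx I I∈ match))

  CounterAt : Counter → Pos w → ℕ → Set
  CounterAt c s x = ∀ i → InConf w s i → IsCounter c (w at i) → toℕ i ≡ suc x + toℕ s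

  CountersAt : Pos w → MConf k → Set
  CountersAt s C = ∀ c → CounterAt c s (value c C)

  counterZero⇔ : ∀ {s} c x → ExactlyOne w s (IsCounter c) → CounterAt c s x → CounterZero w c s ⇔ (x ≡ 0)
  counterZero⇔ {s} c x (i₀ , (ic₀ , ci₀) , _) at = mk⇔ zero⇒ zero⇐
    where
    zero⇒ : CounterZero w c s → x ≡ 0
    zero⇒ (i , i≡ , ci) = +-cancelʳ-≡ (toℕ s) x 0 (suc-injective (trans (sym (at i ic ci)) i≡))
      where
      ic = InConf-prefix w ic₀ (subst (toℕ s ≤_) (sym i≡) (n≤1+n _))
             (subst₂ _≤_ (sym i≡) (sym (at i₀ ic₀ ci₀)) (s≤s (m≤n+m (toℕ s) x)))
    zero⇐ : x ≡ 0 → CounterZero w c s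
    zero⇐ refl = i₀ , at i₀ ic₀ ci₀ , ci₀

  counter-propagates : ∀ {s s'} c x act → Next w s s' → ¬ IsLast w s' → CounterAt c s x →
    (∀ y h → InConf w s' y → IsCounter c (w at y) → InConf w s' h → IsShadow c (w at h) → Moves w act y h) →
    (isZero x ≡ true → act ≢ dec) → CounterAt c s' (apply act x)
  counter-propagates {s} {s'} c x act nx@(sts , sts' , s<s' , _) nl' at mv nz i ic ci =
    Equivalence.to (Moves⇔apply w act x (toℕ s') h≡ nz) (mv i h ic ci ih sh)
    where
    nl : ¬ IsLast w s
    nl (_ , none) = none s' s<s' sts'
    nf' : ¬ IsFirst w s'
    nf' s'≡0 = <⇒≱ s<s' (subst (_≤ toℕ s) (sym s'≡0) z≤n)
    i₀-data = exactlyOne-counter c s sts nl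
    i₀ = proj₁ i₀-data
    ic₀ = proj₁ (proj₁ (proj₂ i₀-data))
    ci₀ = proj₂ (proj₁ (proj₂ i₀-data))
    h-data = exactlyOne-shadow c s' sts' nf' nl'
    h = proj₁ h-data
    ih = proj₁ (proj₁ (proj₂ h-data))
    sh = proj₂ (proj₁ (proj₂ h-data))
    -- Uniformity: the shade from i₀ to h is exactly as long as the configuration of s.
    gap : toℕ h ∸ toℕ i₀ ≡ toℕ s' ∸ toℕ s
    gap = trans (cong (_∸ 1) (proj₂ uniform i₀ h (TrackShade⇒Shade w c (s , s' , nx , ic₀ , ci₀ , ih , sh))))
                (sym (proj₁ uniform s s' nx))
    h≡ : toℕ h ≡ suc x + toℕ s'
    h≡ = equal-gaps (suc x) (≤-trans (<⇒≤ (InConf<Next w nx ic₀)) (proj₁ (proj₂ ih))) (<⇒≤ s<s') gap (at i₀ ic₀ ci₀)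

  Reached : Pos w → Set
  Reached s = ∃[ C ] (Star (Step A) (q₀ A , 0 , 0) C × stateOf (w at s) ≡ just (proj₁ C) ×
                      (¬ IsLast w s → CountersAt s C))

  p₀ : Pos w
  p₀ = proj₁ (first-position w (proj₁ cond1))

  toℕ-p₀ : toℕ p₀ ≡ 0
  toℕ-p₀ = proj₁ (proj₂ (first-position w (proj₁ cond1)))

  w-at-p₀ : w at p₀ ≡ st (q₀ A)
  w-at-p₀ = proj₂ (proj₂ (first-position w (proj₁ cond1)))

  -- Condition (3) makes position 1 a counter, so it is the unique one of the first configuration.
  counters-initial : ¬ IsLast w p₀ → CountersAt p₀ (q₀ A , 0 , 0)
  counters-initial nl c i ic ci =
    trans (cong toℕ (unique i ic ci))
      (trans (cong toℕ (sym (unique p₁ ic₁ (counter-at-1 c p₁ toℕ-p₁ ¬st₁))))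
        (trans toℕ-p₁ (cong suc (sym (trans (cong (_+ toℕ p₀) (value-initial c)) toℕ-p₀)))))
    where
    one = exactlyOne-counter c p₀ (subst IsState (sym w-at-p₀) tt) nl
    i₀ = proj₁ one
    ic₀ = proj₁ (proj₁ (proj₂ one))
    ci₀ = proj₂ (proj₁ (proj₂ one))
    unique = proj₂ (proj₂ one)
    i₀≢0 : toℕ i₀ ≢ 0
    i₀≢0 e = state-not-counter (subst (IsCounter c) (trans (cong (w at_) (toℕ-injective (trans e (sym toℕ-p₀)))) w-at-p₀) ci₀)
      where
      state-not-counter : ¬ IsCounter c (st (q₀ A))
      state-not-counter (inj₁ ())
      state-not-counter (inj₂ ())
    1<∣w∣ : 1 < length w
    1<∣w∣ = ≤-<-trans (n≢0⇒n>0 i₀≢0) (toℕ<n i₀)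
    p₁ = fromℕ< 1<∣w∣
    toℕ-p₁ : toℕ p₁ ≡ 1
    toℕ-p₁ = toℕ-fromℕ< 1<∣w∣
    p₀<p₁ : toℕ p₀ < toℕ p₁
    p₀<p₁ = subst₂ _<_ (sym toℕ-p₀) (sym toℕ-p₁) (s≤s z≤n)
    p₁≤i₀ : toℕ p₁ ≤ toℕ i₀
    p₁≤i₀ = subst (_≤ toℕ i₀) (sym toℕ-p₁) (n≢0⇒n>0 i₀≢0)
    ¬st₁ : ¬ St w p₁
    ¬st₁ = proj₂ (proj₂ ic₀) p₁ p₀<p₁ p₁≤i₀
    ic₁ = InConf-prefix w ic₀ (<⇒≤ p₀<p₁) p₁≤i₀

  reached-p₀ : Reached p₀
  reached-p₀ = (q₀ A , 0 , 0) , ε , cong stateOf w-at-p₀ , counters-initial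

  pL : Pos w
  pL = proj₁ (final-position A w (proj₂ cond1))

  FinalSym-pL : FinalSym A w (w at pL)
  FinalSym-pL = proj₁ (proj₂ (final-position A w (proj₂ cond1)))

  ≤pL : ∀ (i : Pos w) → toℕ i ≤ toℕ pL
  ≤pL = proj₂ (proj₂ (final-position A w (proj₂ cond1)))

  St-pL : St w pL
  St-pL with FinalSym-pL
  ... | _ , _ , inj₁ e = subst IsState (sym e) tt
  ... | _ , _ , inj₂ e = subst IsState (sym e) tt

  final-at-pL : ∀ {q} → stateOf (w at pL) ≡ just q → q ∈ final A
  final-at-pL st≡ with FinalSym-pL
  ... | q , q∈ , inj₁ e = subst (_∈ final A) (just-injective (trans (sym (cong stateOf e)) st≡)) q∈
  ... | q , q∈ , inj₂ e = subst (_∈ final A) (just-injective (trans (sym (cong stateOf e)) st≡)) q∈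

  StateAt : ℕ → Set
  StateAt t = Σ (t < length w) λ t< → St w (fromℕ< t<)

  stateAt? : ∀ t → Dec (StateAt t)
  stateAt? t with t <? length w
  ... | no t≮ = no (t≮ ∘ proj₁)
  ... | yes t< with isState? (w at fromℕ< t<)
  ...   | yes st-t = yes (t< , st-t)
  ...   | no ¬st = no λ (t<' , st-t) → ¬st (subst (λ h → St w (fromℕ< h)) (<-irrelevant t<' t<) st-t)

  St⇒StateAt : ∀ p → St w p → StateAt (toℕ p)
  St⇒StateAt p st-p = toℕ<n p , subst (St w) (sym (fromℕ<-toℕ p (toℕ<n p))) st-p

  next-state : ∀ s j → St w s → toℕ s < toℕ j → St w j → ∃[ s' ] Next w s s'
  next-state s j sts s<j stj with least-after stateAt? s<j (St⇒StateAt j stj)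
  ... | t , s<t , (t< , st-t) , none =
    fromℕ< t< , sts , st-t , subst (toℕ s <_) (sym (toℕ-fromℕ< t<)) s<t ,
    λ j' s<j' j'<s' stj' → none (toℕ j') s<j' (subst (toℕ j' <_) (toℕ-fromℕ< t<) j'<s') (St⇒StateAt j' stj')

  step : ∀ s → St w s → toℕ s < toℕ pL → ((C , _) : Reached s) → proj₁ C ∉ final A →
    ∃[ s' ] (toℕ s < toℕ s' × St w s' × Reached s')
  step s sts s<pL (C , ρ , st≡ , counters) q∉ =
    s' , s<s' , sts' ,
    after I C , ρ ◅◅ (Step-after A I∈ fromI zeroTest-I ◅ ε) , proj₁ (cond6 s s' nx I I∈ match) ,
    λ nl' c i ic ci → trans (counter-propagates c (value c C) (action c I) nx nl' (at c) (moves nx I I∈ match c)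
                               (λ z → NoZeroDecrement-at A nzd I∈ c (trans (zeroTest-I c) z)) i ic ci)
                            (cong (λ y → suc y + toℕ s') (sym (value-after c I C)))
    where
    nl : ¬ IsLast w s
    nl (_ , none) = none pL s<pL St-pL
    at : CountersAt s C
    at = counters nl
    chosen = complete (proj₁ C) q∉ (isZero (value first C)) (isZero (value second C))
    I = proj₁ chosen
    I∈ = proj₁ (proj₂ chosen)
    fromI = proj₁ (proj₂ (proj₂ chosen))
    zeroTest-I : ∀ c → zeroTest c I ≡ isZero (value c C)
    zeroTest-I first  = proj₁ (proj₂ (proj₂ (proj₂ chosen)))
    zeroTest-I second = proj₂ (proj₂ (proj₂ (proj₂ chosen)))
    agree : ∀ c → Agree (zeroTest c I) (CounterZero w c s)
    agree c = let zero⇔ = counterZero⇔ c (value c C) (exactlyOne-counter c s sts nl) (at c) in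
      subst (λ b → Agree b (CounterZero w c s)) (sym (zeroTest-I c))
            (isZero-Agree (value c C) (Equivalence.to zero⇔) (Equivalence.from zero⇔))
    match : MatchesAssumption A w s I
    match = trans st≡ (cong just (sym fromI)) , agree first , agree second
    s'-data = next-state s pL sts s<pL St-pL
    s' = proj₁ s'-data
    nx = proj₂ s'-data
    sts' = proj₁ (proj₂ nx)
    s<s' = proj₁ (proj₂ (proj₂ nx))

  accepts-from : ∀ fuel s → toℕ pL < fuel + toℕ s → St w s → Reached s → Accepts A
  accepts-from zero s bound _ _ = ⊥-elim (<⇒≱ bound (≤pL s))
  accepts-from (suc fuel) s bound sts reached@(C , ρ , st≡ , _) with proj₁ C ∈? final A
  ... | yes q∈ = proj₁ C , proj₁ (proj₂ C) , proj₂ (proj₂ C) , ρ , q∈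
  ... | no q∉ with toℕ s <? toℕ pL
  ...   | no s≮pL = ⊥-elim (q∉ (final-at-pL (subst (λ p → stateOf (w at p) ≡ just (proj₁ C)) s≡pL st≡)))
    where s≡pL = toℕ-injective (≤-antisym (≤pL s) (≮⇒≥ s≮pL))
  ...   | yes s<pL =
    let (s' , s<s' , sts' , reached') = step s sts s<pL reached q∉ in
    accepts-from fuel s' (<-≤-trans bound (subst (_≤ fuel + toℕ s') (+-suc fuel (toℕ s)) (+-monoʳ-≤ fuel s<s')))
      sts' reached'

  accepts : Accepts A
  accepts = accepts-from (suc (toℕ pL)) p₀ (s≤s (m≤m+n (toℕ pL) (toℕ p₀)))
    (subst IsState (sym w-at-p₀) tt) reached-p₀

lemma1 : ∀ {k : ℕ} (A : Automaton k) →
    Deterministic A → Complete A → NoZeroDecrement A →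
    Accepts A ⇔ (∃[ w ] ∃[ n ] (InL A w × Uniform w n))
lemma1 A det complete nzd = mk⇔ run⇒word word⇒run
  where
  run⇒word : Accepts A → ∃[ w ] ∃[ n ] (InL A w × Uniform w n)
  run⇒word (_ , _ , _ , run , final-C) = let open FromRun A det nzd run final-C in w , suc m , inL , uniform
  word⇒run : ∃[ w ] ∃[ n ] (InL A w × Uniform w n) → Accepts A
  word⇒run (w , _ , (cond1 , _ , cond3 , cond4 , _ , cond6) , uniform) =
    ToRun.accepts A complete nzd w cond1 cond3 cond4 cond6 uniform
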